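{- Let $N=\{1,\ldots,n\}$, let $\mathcal{F}\subseteq 2^N$ be intersection-closed, let $1\le j\le i\le n$, let $A$ be a discarding set at level $i$ and $B$ a discarding set at level $j$ with $A\neq B$. Then $\mathcal{H}^A_i\cap\mathcal{H}^B_j=\varnothing$.
   Context: A family $\mathcal{F}\subseteq 2^N$ is intersection-closed if $A\cap B\in\mathcal{F}$ for all $A,B\in\mathcal{F}$. $[i]=\{1,\ldots,i\}$. A set $A$ is discarding at level $i$ if $A\subseteq[i-1]$, $A\in\mathcal{F}$ and $A\cup\{i\}\notin\mathcal{F}$. For such $A$: if there is no $X\subseteq\{i+1,\ldots,n\}$ with $A\cup\{i\}\cup X\in\mathcal{F}$, then $A$ has no root; otherwise all such $X$ have a common element, and a root of $A$ is a (fixed) element $k>i$ lying in every such $X$. Define $\mathcal{H}^A_i=\{A\cup\{i\}\cup X : X\subseteq\{i+1,\ldots,n\}\}$ if $A$ has no root, and $\mathcal{H}^A_i=\{A\cup\{i\}\cup X : X\subseteq\{i+1,\ldots,n\},\ k\notin X\}$ if $A$ has root $k$. -}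

module Defs where

-- Ground set N = {1,…,n} is modelled by Fin n; the element m ∈ N
-- corresponds to the index (m-1) : Fin n.  A level i ∈ N is likewise an
-- index i : Fin n, and "x ∈ [i-1]" becomes "toℕ x < toℕ i",
-- "x ∈ {i+1,…,n}" becomes "toℕ i < toℕ x".

open import Data.Nat using (ℕ; _<_)
open import Data.Fin using (Fin; toℕ)
open import Data.Fin.Subset using (Subset; _∈_; _∉_; _∪_; _∩_; ⁅_⁆)
open import Data.Product using (Σ; _×_; ∃)
open import Relation.Nullary using (¬_)
open import Relation.Binary.PropositionalEquality using (_≡_)

Family : ℕ → Set₁
Family n = Subset n → Set

IntersectionClosed : ∀ {n} → Family n → Set
IntersectionClosed F = ∀ A B → F A → F B → F (A ∩ B)

BelowLevel : ∀ {n} → Fin n → Subset n → Set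
BelowLevel i A = ∀ x → x ∈ A → toℕ x < toℕ i

AboveLevel : ∀ {n} → Fin n → Subset n → Set
AboveLevel i X = ∀ x → x ∈ X → toℕ i < toℕ x

Discarding : ∀ {n} → Family n → Fin n → Subset n → Set
Discarding F i A = BelowLevel i A × F A × ¬ F (A ∪ ⁅ i ⁆)

Extension : ∀ {n} → Family n → Fin n → Subset n → Subset n → Set
Extension F i A X = AboveLevel i X × F ((A ∪ ⁅ i ⁆) ∪ X)

data RootChoice {n} (F : Family n) (i : Fin n) (A : Subset n) : Set where
  noRoot : ¬ (∃ λ X → Extension F i A X) → RootChoice F i A
  root   : (k : Fin n) → toℕ i < toℕ k →
           (∃ λ X → Extension F i A X) →
           (∀ X → Extension F i A X → k ∈ X) → RootChoice F i A

Allowed : ∀ {n} {F : Family n} {i : Fin n} {A : Subset n} →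
          RootChoice F i A → Subset n → Set
Allowed {i = i} (noRoot _) X = AboveLevel i X
Allowed {i = i} (root k _ _ _) X = AboveLevel i X × k ∉ X

InH : ∀ {n} (F : Family n) (i : Fin n) (A : Subset n) →
      RootChoice F i A → Subset n → Set
InH F i A r C = ∃ λ X → Allowed r X × (C ≡ (A ∪ ⁅ i ⁆) ∪ X)

module Submission where

open import Defs
open import Data.Nat using (ℕ; _≤_; _<_)
open import Data.Nat.Properties using (<-irrefl; <-asym; <-cmp; <-trans; m≤n⇒m<n∨m≡n)
open import Data.Fin using (Fin; toℕ)
open import Data.Fin.Properties using (toℕ-injective)
open import Data.Fin.Subset using (Subset; _∈_; _∪_; _∩_; ⁅_⁆; ∁; _⊆_)
open import Data.Fin.Subset.Properties
  using (x∈⁅x⁆; x∈⁅y⁆⇒x≡y; ⊆-antisym; x∈∁p⇒x∉p; x∉p⇒x∈∁p; x∈p∩q⁺; x∈p∩q⁻; x∈p∪q⁻; x∈p∪q⁺; _∈?_)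
open import Data.Product using (_×_; _,_; proj₁)
open import Data.Sum using (inj₁; inj₂)
open import Data.Empty using (⊥; ⊥-elim)
open import Relation.Nullary using (¬_; yes; no)
open import Relation.Binary using (tri<; tri≈; tri>)
open import Relation.Binary.PropositionalEquality using (_≡_; sym; trans; cong; subst)

-- A set C ∈ H^A_i is cut by the level i into a lower part A ⊆ [i-1], the
-- element i itself and an upper part X ⊆ {i+1,…,n}; both parts can be read
-- off C. For A ≠ B this forces j < i, and then the part of A above j is an
-- extension of B at level j lying inside the upper part Y of C at level j.
-- If B has no root this is absurd, and otherwise the root of B would lie in Y.

private
  variable
    n : ℕ
    i j x : Fin n
    A B X Y D : Subset n

layered : Fin n → Subset n → Subset n → Subset n
layered i A X = (A ∪ ⁅ i ⁆) ∪ X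

⊆-layered : A ⊆ layered i A X
⊆-layered xA = x∈p∪q⁺ (inj₁ (x∈p∪q⁺ (inj₁ xA)))

level∈layered : i ∈ layered i A X
level∈layered {i = i} = x∈p∪q⁺ (inj₁ (x∈p∪q⁺ (inj₂ (x∈⁅x⁆ i))))

∈-layered-below : AboveLevel i X → toℕ x < toℕ i → x ∈ layered i A X → x ∈ A
∈-layered-below {i = i} {X} {x} {A} above x<i x∈ with x∈p∪q⁻ (A ∪ ⁅ i ⁆) X x∈
... | inj₂ xX = ⊥-elim (<-asym x<i (above x xX))
... | inj₁ x∈A∪i with x∈p∪q⁻ A ⁅ i ⁆ x∈A∪i
...   | inj₁ xA = xA
...   | inj₂ xi = ⊥-elim (<-irrefl (cong toℕ (x∈⁅y⁆⇒x≡y i xi)) x<i)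

∈-layered-above : BelowLevel i A → toℕ i < toℕ x → x ∈ layered i A X → x ∈ X
∈-layered-above {i = i} {A} {x} {X} below i<x x∈ with x∈p∪q⁻ (A ∪ ⁅ i ⁆) X x∈
... | inj₂ xX = xX
... | inj₁ x∈A∪i with x∈p∪q⁻ A ⁅ i ⁆ x∈A∪i
...   | inj₁ xA = ⊥-elim (<-asym i<x (below x xA))
...   | inj₂ xi = ⊥-elim (<-irrefl (cong toℕ (sym (x∈⁅y⁆⇒x≡y i xi))) i<x)

layered-injectiveˡ : BelowLevel i A → BelowLevel i B → AboveLevel i X → AboveLevel i Y →
                     layered i A X ≡ layered i B Y → A ≡ B
layered-injectiveˡ belowA belowB aboveX aboveY e = ⊆-antisym
  (λ {x} xA → ∈-layered-below aboveY (belowA x xA) (subst (x ∈_) e (⊆-layered xA)))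
  (λ {x} xB → ∈-layered-below aboveX (belowB x xB) (subst (x ∈_) (sym e) (⊆-layered xB)))

p⊆q⇒p∪[q∩∁p]≡q : ∀ {p q : Subset n} → p ⊆ q → p ∪ (q ∩ ∁ p) ≡ q
p⊆q⇒p∪[q∩∁p]≡q {p = p} {q} p⊆q = ⊆-antisym ⊆q q⊆
  where
  ⊆q : p ∪ (q ∩ ∁ p) ⊆ q
  ⊆q x∈ with x∈p∪q⁻ p (q ∩ ∁ p) x∈
  ... | inj₁ xp = p⊆q xp
  ... | inj₂ x∈q∩∁p = proj₁ (x∈p∩q⁻ q (∁ p) x∈q∩∁p)
  q⊆ : q ⊆ p ∪ (q ∩ ∁ p)
  q⊆ {x} xq with x ∈? p
  ... | yes xp = x∈p∪q⁺ (inj₁ xp)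
  ... | no x∉p = x∈p∪q⁺ (inj₂ (x∈p∩q⁺ (xq , x∉p⇒x∈∁p x∉p)))

upper : Fin n → Subset n → Subset n → Subset n
upper j B D = D ∩ ∁ (B ∪ ⁅ j ⁆)

upper-aboveLevel : AboveLevel j Y → D ⊆ layered j B Y → AboveLevel j (upper j B D)
upper-aboveLevel {j = j} {D = D} {B = B} aboveY D⊆ x x∈ with x∈p∩q⁻ D (∁ (B ∪ ⁅ j ⁆)) x∈
... | xD , x∈∁ with <-cmp (toℕ j) (toℕ x)
...   | tri< j<x _ _ = j<x
...   | tri≈ _ j≡x _ = ⊥-elim (x∈∁p⇒x∉p x∈∁
          (x∈p∪q⁺ (inj₂ (subst (_∈ ⁅ j ⁆) (toℕ-injective j≡x) (x∈⁅x⁆ j)))))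
...   | tri> _ _ x<j = ⊥-elim (x∈∁p⇒x∉p x∈∁
          (x∈p∪q⁺ (inj₁ (∈-layered-below aboveY x<j (D⊆ xD)))))

upper⊆ : BelowLevel j B → AboveLevel j Y → D ⊆ layered j B Y → upper j B D ⊆ Y
upper⊆ {j = j} {B = B} {D = D} belowB aboveY D⊆ {x} x∈ =
  ∈-layered-above belowB (upper-aboveLevel aboveY D⊆ x x∈)
    (D⊆ (proj₁ (x∈p∩q⁻ D (∁ (B ∪ ⁅ j ⁆)) x∈)))

lower-layer⊆ : toℕ j < toℕ i → BelowLevel j B → AboveLevel i X →
               layered j B Y ≡ layered i A X → B ∪ ⁅ j ⁆ ⊆ A
lower-layer⊆ {j = j} {i = i} {B = B} j<i belowB aboveX e x∈ with x∈p∪q⁻ B ⁅ j ⁆ x∈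
... | inj₁ xB = ∈-layered-below aboveX (<-trans (belowB _ xB) j<i) (subst (_ ∈_) e (⊆-layered xB))
... | inj₂ xj rewrite x∈⁅y⁆⇒x≡y j xj = ∈-layered-below aboveX j<i (subst (j ∈_) e level∈layered)

aboveLevel : ∀ {F : Family n} (r : RootChoice F i A) → Allowed r X → AboveLevel i X
aboveLevel (noRoot _) above = above
aboveLevel (root _ _ _ _) (above , _) = above

allowed⇒¬extension⊆ : ∀ {F : Family n} (r : RootChoice F j B) →
                      Allowed r Y → Extension F j B X → X ⊆ Y → ⊥
allowed⇒¬extension⊆ (noRoot none) _ ext _ = none (_ , ext)
allowed⇒¬extension⊆ (root k _ _ k∈ext) (_ , k∉Y) ext X⊆Y = k∉Y (X⊆Y (k∈ext _ ext))

lemma3 : ∀ {n} (F : Family n) → IntersectionClosed F →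
    (i j : Fin n) → toℕ j ≤ toℕ i →
    (A B : Subset n) → Discarding F i A → Discarding F j B → ¬ (A ≡ B) →
    (rA : RootChoice F i A) (rB : RootChoice F j B) →
    (C : Subset n) → ¬ (InH F i A rA C × InH F j B rB C)
lemma3 F _ i j j≤i A B (belowA , FA , _) (belowB , _ , _) A≢B rA rB C
       ((X , allowedX , C≡A) , (Y , allowedY , C≡B))
  with m≤n⇒m<n∨m≡n j≤i
... | inj₂ j≡i rewrite toℕ-injective j≡i =
  A≢B (layered-injectiveˡ belowA belowB aboveX aboveY (trans (sym C≡A) C≡B))
  where
  aboveX : AboveLevel i X
  aboveX = aboveLevel rA allowedX
  aboveY : AboveLevel i Y
  aboveY = aboveLevel rB allowedY
... | inj₁ j<i = allowed⇒¬extension⊆ rB allowedY extension (upper⊆ belowB aboveY A⊆C)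
  where
  aboveY : AboveLevel j Y
  aboveY = aboveLevel rB allowedY
  A⊆C : A ⊆ layered j B Y
  A⊆C {x} xA = subst (x ∈_) (trans (sym C≡A) C≡B) (⊆-layered xA)
  A≡layered : A ≡ layered j B (upper j B A)
  A≡layered = sym (p⊆q⇒p∪[q∩∁p]≡q
    (lower-layer⊆ j<i belowB (aboveLevel rA allowedX) (trans (sym C≡B) C≡A)))
  extension : Extension F j B (upper j B A)
  extension = upper-aboveLevel aboveY A⊆C , subst F A≡layered FA
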